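{- Let $n\ge 3$. Then $\mathcal P_n$ is a simplicial complex on the vertex set $[3,n]$, and it has dimension $\lfloor\frac{n-1}{2}\rfloor-1$.
   Context: $[m,n]=\{m,m+1,\dots,n\}$, $[n]=[1,n]$, and $\mathfrak S_n$ is the set of permutations of $[n]$ in one-line notation. The circular peak set of $\sigma\in\mathfrak S_n$ is $CP(\sigma)=\{\sigma(i)\mid 2\le i\le n-1,\ \sigma(i-1)<\sigma(i)>\sigma(i+1)\}$; for $S\subseteq[n]$, $CP_n(S)=\{\sigma\in\mathfrak S_n\mid CP(\sigma)=S\}$, and $\mathcal P_n=\{S\subseteq[n]\mid CP_n(S)\neq\emptyset\}$, ordered by inclusion. A simplicial complex $\Delta$ on a vertex set $V$ is a collection of subsets of $V$ such that $\{x\}\in\Delta$ for every $x\in V$ and $T\in\Delta$ whenever $T\subseteq S\in\Delta$. The dimension of a face $S$ is $|S|-1$ (so $\emptyset$ has dimension $-1$), and the dimension of the complex is the maximum dimension of its faces. -}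

module Defs where

open import Data.Nat using (ℕ; suc; _≤_; _/_; _∸_)
open import Data.Integer using (ℤ; +_; _-_; _≤_)
open import Data.Fin using (Fin; toℕ; _<_; _>_)
open import Data.Fin.Subset using (Subset; _∈_; _⊆_; ⁅_⁆; ∣_∣)
open import Data.Fin.Permutation using (Permutation′; _⟨$⟩ʳ_)
open import Data.Product using (Σ; ∃; _×_; _,_)
open import Relation.Binary.PropositionalEquality using (_≡_)
open import Function.Bundles using (_⇔_)

-- Encoding: the integer x ∈ [n] is represented by the element k : Fin n
-- with toℕ k + 1 ≡ x (values shifted down by one); likewise positions.

-- v (encoded) is a circular peak value of σ: there are consecutive
-- positions i, j = i+1, k = j+1 (so j ranges over 2..n-1 in 1-based terms)
-- with σ(i) < σ(j) > σ(k) and σ(j) = v.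
IsCircPeak : {n : ℕ} → Permutation′ n → Fin n → Set
IsCircPeak {n} σ v =
  Σ (Fin n) λ i → Σ (Fin n) λ j → Σ (Fin n) λ k →
    (toℕ j ≡ suc (toℕ i)) × (toℕ k ≡ suc (toℕ j)) ×
    ((σ ⟨$⟩ʳ i) < (σ ⟨$⟩ʳ j)) × ((σ ⟨$⟩ʳ j) > (σ ⟨$⟩ʳ k)) ×
    ((σ ⟨$⟩ʳ j) ≡ v)

HasCircPeakSet : {n : ℕ} → Permutation′ n → Subset n → Set
HasCircPeakSet {n} σ S = (v : Fin n) → (v ∈ S) ⇔ IsCircPeak σ v

InP : (n : ℕ) → Subset n → Set
InP n S = ∃ λ (σ : Permutation′ n) → HasCircPeakSet σ S

InVertexRange : {n : ℕ} → ℕ → Fin n → Set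
InVertexRange a v = a Data.Nat.≤ suc (toℕ v)

IsSimplicialComplexOn : (n a : ℕ) → (Subset n → Set) → Set
IsSimplicialComplexOn n a 𝒞 =
  ((S : Subset n) → 𝒞 S → (v : Fin n) → v ∈ S → InVertexRange a v) ×
  ((v : Fin n) → InVertexRange a v → 𝒞 ⁅ v ⁆) ×
  ((S T : Subset n) → T ⊆ S → 𝒞 S → 𝒞 T)

faceDim : {n : ℕ} → Subset n → ℤ
faceDim S = + ∣ S ∣ - + 1

HasDimension : (n : ℕ) → (Subset n → Set) → ℤ → Set
HasDimension n 𝒞 d =
  (∃ λ (S : Subset n) → 𝒞 S × (faceDim S ≡ d)) ×
  ((S : Subset n) → 𝒞 S → faceDim S Data.Integer.≤ d)

-- S ∈ 𝒫_n exactly when the ballot condition 2 |S ∩ [m]| ≤ m - 1 holds for every m.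
-- Necessity: a peak has two smaller neighbours and no two peaks are adjacent, so the
-- c peaks of value ≤ m together with their neighbours fill at least 2c + 1 positions,
-- all carrying values ≤ m. Sufficiency: write the values 1, 2, … in increasing order,
-- parking non-peaks; a peak is placed between the two least parked values, which the
-- ballot condition guarantees to exist. The condition is inherited by subsets, forces
-- every peak to be at least 3, holds for each {v} with v ≥ 3, and is tight for
-- {3, 5, 7, …}, of size ⌊(n - 1)/2⌋.

module Submission where

open import Defs
open import Data.Nat using (ℕ; _≤_; _/_; _∸_)
open import Data.Integer using (+_; _-_)
open import Data.Product using (_×_)

open import Data.Nat using (zero; suc; _+_; _*_; _<_; z≤n; s≤s; s≤s⁻¹; _<?_; _≟_; pred)
open import Data.Nat.Properties
open import Data.Nat.DivMod using (m*n/n≡m; /-monoˡ-≤; m/n≡1+[m∸n]/n)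
import Data.Integer as ℤ
import Data.Integer.Properties as ℤ
open import Data.Fin as Fin using (Fin; toℕ; fromℕ<)
import Data.Fin.Properties as Finₚ
open import Data.Vec using ([]; _∷_; here; there)
open import Data.Fin.Subset using (Subset; outside; inside; ⁅_⁆; ∣_∣)
  renaming (_∈_ to _∈ₛ_; _⊆_ to _⊆ₛ_; ⊥ to ∅)
open import Data.Fin.Subset.Properties using (drop-∷-⊆)
open import Data.Fin.Permutation
  using (Permutation′; _⟨$⟩ʳ_; permutation)
open import Data.List
  using (List; []; _∷_; _++_; _∷ʳ_; length; filter; tabulate; applyUpTo; upTo)
open import Data.List.Properties
  using ( filter-accept; filter-reject; filter-some; filter-none
        ; length-tabulate; length-upTo; length-++; ++-assoc; ++-identityʳ)
open import Data.List.Membership.Propositional using (_∈_)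
open import Data.List.Membership.Propositional.Properties using (∈-upTo⁺; ∈-upTo⁻)
open import Data.List.Relation.Unary.Any as Any using (here; there)
open import Data.List.Relation.Unary.All as All using (All; []; _∷_)
import Data.List.Relation.Unary.All.Properties as All
open import Data.List.Relation.Unary.AllPairs using (AllPairs; []; _∷_)
import Data.List.Relation.Unary.AllPairs.Properties as AllPairs
open import Data.List.Relation.Unary.Unique.Propositional using (Unique)
open import Data.List.Relation.Unary.Unique.Propositional.Properties using (upTo⁺; tabulate⁺)
open import Data.List.Relation.Binary.Permutation.Propositional
  using (_↭_; prep; ↭-sym; ↭-reflexive; ↭⇒↭ₛ; module PermutationReasoning)
open import Data.List.Relation.Binary.Permutation.Propositional.Properties
  using (↭-length; ∈-resp-↭; shift)
open import Relation.Binary.Definitions using (tri<; tri≈; tri>)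
open import Relation.Binary.PropositionalEquality
open import Data.List.Relation.Binary.Permutation.Setoid.Properties (setoid ℕ)
  using (Unique-resp-↭)
open import Data.Product as Product using (Σ; ∃; _,_; proj₁; proj₂)
open import Data.Sum as Sum using (_⊎_; inj₁; inj₂; [_,_]′)
open import Data.Unit using (⊤; tt)
open import Function using (_∘_)
open import Function.Bundles using (_⇔_; mk⇔; Equivalence; Injection)
open import Function.Properties.Inverse using (↔⇒↣)
open import Function.Properties.Equivalence using () renaming (trans to ⇔-trans; sym to ⇔-sym)
open import Relation.Nullary using (¬_; Dec; yes; no; contradiction)
open import Relation.Nullary.Decidable using (_×-dec_)

private variable
  a m n p w : ℕ
  xs : List ℕ

-- Out of range, nth returns the junk value 0; every use below carries a bound.
nth : List ℕ → ℕ → ℕ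
nth []       _       = 0
nth (x ∷ _)  zero    = x
nth (_ ∷ xs) (suc p) = nth xs p

nth-∈ : p < length xs → nth xs p ∈ xs
nth-∈ {zero}  {_ ∷ _}  _         = here refl
nth-∈ {suc p} {_ ∷ xs} (s≤s p<n) = there (nth-∈ p<n)

∈⇒nth : w ∈ xs → ∃ λ p → p < length xs × nth xs p ≡ w
∈⇒nth (here refl) = 0 , s≤s z≤n , refl
∈⇒nth (there w∈)  = Product.map suc (Product.map₁ s≤s) (∈⇒nth w∈)

nth-injective : Unique xs → ∀ {p q} → p < length xs → q < length xs →
                nth xs p ≡ nth xs q → p ≡ q
nth-injective _            {zero}  {zero}  _         _         _  = refl
nth-injective (x∉xs ∷ _)   {zero}  {suc q} _         (s≤s q<n) eq =
  contradiction eq (All.lookup x∉xs (nth-∈ q<n))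
nth-injective (x∉xs ∷ _)   {suc p} {zero}  (s≤s p<n) _         eq =
  contradiction (sym eq) (All.lookup x∉xs (nth-∈ p<n))
nth-injective (_ ∷ unique) {suc p} {suc q} (s≤s p<n) (s≤s q<n) eq =
  cong suc (nth-injective unique p<n q<n eq)

nth-tabulate : ∀ (f : Fin n → ℕ) i → nth (tabulate f) (toℕ i) ≡ f i
nth-tabulate f Fin.zero    = refl
nth-tabulate f (Fin.suc i) = nth-tabulate (f ∘ Fin.suc) i

-- Peaks of a list

consIf : {P : Set} → Dec P → ℕ → List ℕ → List ℕ
consIf (yes _) x xs = x ∷ xs
consIf (no _)  _ xs = xs

∈-consIf⁻ : ∀ {P : Set} (d : Dec P) → w ∈ consIf d a xs → (w ≡ a × P) ⊎ w ∈ xs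
∈-consIf⁻ (yes pa) (here refl) = inj₁ (refl , pa)
∈-consIf⁻ (yes _)  (there w∈)  = inj₂ w∈
∈-consIf⁻ (no _)   w∈          = inj₂ w∈

peaks : List ℕ → List ℕ
peaks (a ∷ b ∷ c ∷ r) = consIf (a <? b ×-dec c <? b) b (peaks (b ∷ c ∷ r))
peaks _               = []

peaks-peak : ∀ {a b c} r → a < b → c < b →
             peaks (a ∷ b ∷ c ∷ r) ≡ b ∷ peaks (b ∷ c ∷ r)
peaks-peak {a} {b} {c} _ a<b c<b with a <? b ×-dec c <? b
... | yes _      = refl
... | no notPeak = contradiction (a<b , c<b) notPeak

peaks-notPeak : ∀ {a b c} r → ¬ (a < b × c < b) →
                peaks (a ∷ b ∷ c ∷ r) ≡ peaks (b ∷ c ∷ r)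
peaks-notPeak {a} {b} {c} _ notPeak with a <? b ×-dec c <? b
... | yes peak = contradiction peak notPeak
... | no _     = refl

peaks-descent : ∀ {b c} r → c < b → peaks (b ∷ c ∷ r) ≡ peaks (c ∷ r)
peaks-descent []      _   = refl
peaks-descent (_ ∷ r) c<b = peaks-notPeak r λ (b<c , _) → <-asym b<c c<b

peaks-sorted : AllPairs _<_ xs → peaks xs ≡ []
peaks-sorted []           = refl
peaks-sorted (_ ∷ [])     = refl
peaks-sorted (_ ∷ _ ∷ []) = refl
peaks-sorted {_ ∷ _ ∷ _ ∷ r} ((_ ∷ _) ∷ sorted@((b<c ∷ _) ∷ _)) =
  trans (peaks-notPeak r λ (_ , c<b) → <-asym b<c c<b) (peaks-sorted sorted)

PeakAt : List ℕ → ℕ → ℕ → Set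
PeakAt xs w p =
  2 + p < length xs × nth xs (1 + p) ≡ w × nth xs p < w × nth xs (2 + p) < w

PeakAt-∷ : ∀ {x} → ∃ (PeakAt xs w) → ∃ (PeakAt (x ∷ xs) w)
PeakAt-∷ (p , bound , peak) = suc p , s≤s bound , peak

∈-peaks⁺ : ∀ xs p → PeakAt xs w p → w ∈ peaks xs
∈-peaks⁺ (_ ∷ _ ∷ _ ∷ r) zero (_ , refl , a<b , c<b)
  rewrite peaks-peak r a<b c<b = here refl
∈-peaks⁺ (a ∷ b ∷ c ∷ r) (suc p) (s≤s bound , peak) with a <? b ×-dec c <? b
... | yes _ = there (∈-peaks⁺ (b ∷ c ∷ r) p (bound , peak))
... | no _  = ∈-peaks⁺ (b ∷ c ∷ r) p (bound , peak)
∈-peaks⁺ (_ ∷ _ ∷ []) _ (s≤s (s≤s ()) , _)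

∈-peaks⁻ : ∀ xs → w ∈ peaks xs → ∃ (PeakAt xs w)
∈-peaks⁻ (a ∷ b ∷ c ∷ r) w∈ =
  [ (λ { (refl , a<b , c<b) → 0 , s≤s (s≤s (s≤s z≤n)) , refl , a<b , c<b })
  , PeakAt-∷ ∘ ∈-peaks⁻ (b ∷ c ∷ r)
  ]′ (∈-consIf⁻ (a <? b ×-dec c <? b) w∈)

∈-peaks⇔ : w ∈ peaks xs ⇔ ∃ (PeakAt xs w)
∈-peaks⇔ {xs = xs} = mk⇔ (∈-peaks⁻ xs) λ (p , peak) → ∈-peaks⁺ xs p peak

countBelow : ℕ → List ℕ → ℕ
countBelow m = length ∘ filter (_<? m)

occurrences : ℕ → List ℕ → ℕ
occurrences m = length ∘ filter (_≟ m)

countBelow-accept : ∀ xs → a < m → countBelow m (a ∷ xs) ≡ suc (countBelow m xs)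
countBelow-accept _ a<m = cong length (filter-accept (_<? _) a<m)

countBelow-reject : ∀ xs → ¬ a < m → countBelow m (a ∷ xs) ≡ countBelow m xs
countBelow-reject _ a≮m = cong length (filter-reject (_<? _) a≮m)

occurrences-accept : ∀ xs → a ≡ m → occurrences m (a ∷ xs) ≡ suc (occurrences m xs)
occurrences-accept _ a≡m = cong length (filter-accept (_≟ _) a≡m)

occurrences-reject : ∀ xs → a ≢ m → occurrences m (a ∷ xs) ≡ occurrences m xs
occurrences-reject _ a≢m = cong length (filter-reject (_≟ _) a≢m)

countBelow-∷ : ∀ m a xs → countBelow m xs ≤ countBelow m (a ∷ xs)
countBelow-∷ m a xs with a <? m
... | yes a<m = ≤-trans (n≤1+n _) (≤-reflexive (sym (countBelow-accept xs a<m)))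
... | no a≮m  = ≤-reflexive (sym (countBelow-reject xs a≮m))

countBelow-suc : ∀ m xs → countBelow (suc m) xs ≡ countBelow m xs + occurrences m xs
countBelow-suc m []       = refl
countBelow-suc m (x ∷ xs) with <-cmp x m
... | tri< x<m x≢m _ = begin
  countBelow (suc m) (x ∷ xs)                    ≡⟨ countBelow-accept xs (m<n⇒m<1+n x<m) ⟩
  suc (countBelow (suc m) xs)                    ≡⟨ cong suc (countBelow-suc m xs) ⟩
  suc (countBelow m xs) + occurrences m xs       ≡⟨ cong₂ _+_ (sym (countBelow-accept xs x<m))
                                                              (sym (occurrences-reject xs x≢m)) ⟩
  countBelow m (x ∷ xs) + occurrences m (x ∷ xs) ∎
  where open ≡-Reasoning
... | tri≈ x≮m refl _ = begin
  countBelow (suc x) (x ∷ xs)                    ≡⟨ countBelow-accept xs (n<1+n x) ⟩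
  suc (countBelow (suc x) xs)                    ≡⟨ cong suc (countBelow-suc x xs) ⟩
  suc (countBelow x xs + occurrences x xs)       ≡⟨ +-suc _ _ ⟨
  countBelow x xs + suc (occurrences x xs)       ≡⟨ cong₂ _+_ (sym (countBelow-reject xs x≮m))
                                                              (sym (occurrences-accept xs refl)) ⟩
  countBelow x (x ∷ xs) + occurrences x (x ∷ xs) ∎
  where open ≡-Reasoning
... | tri> x≮m x≢m m<x = begin
  countBelow (suc m) (x ∷ xs)                    ≡⟨ countBelow-reject xs (<⇒≱ m<x ∘ s≤s⁻¹) ⟩
  countBelow (suc m) xs                          ≡⟨ countBelow-suc m xs ⟩
  countBelow m xs + occurrences m xs             ≡⟨ cong₂ _+_ (sym (countBelow-reject xs x≮m))
                                                              (sym (occurrences-reject xs x≢m)) ⟩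
  countBelow m (x ∷ xs) + occurrences m (x ∷ xs) ∎
  where open ≡-Reasoning

occurrences-∈ : m ∈ xs → 1 ≤ occurrences m xs
occurrences-∈ m∈xs = filter-some (_≟ _) (Any.map sym m∈xs)

occurrences-∉ : All (m ≢_) xs → occurrences m xs ≡ 0
occurrences-∉ m∉xs = cong length (filter-none (_≟ _) (All.map (_∘ sym) m∉xs))

occurrences-unique : Unique xs → occurrences m xs ≤ 1
occurrences-unique []                   = z≤n
occurrences-unique {x ∷ xs} {m} (x∉xs ∷ unique) with x ≟ m
... | yes refl =
  ≤-reflexive (trans (occurrences-accept xs refl) (cong suc (occurrences-∉ x∉xs)))
... | no x≢m   =
  ≤-trans (≤-reflexive (occurrences-reject xs x≢m)) (occurrences-unique unique)

countBelow-unique : Unique xs → countBelow m xs ≤ m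
countBelow-unique {xs} {zero} _ =
  ≤-reflexive (cong length (filter-none (_<? 0) (All.universal (λ _ ()) xs)))
countBelow-unique {xs} {suc m} unique = begin
  countBelow (suc m) xs              ≡⟨ countBelow-suc m xs ⟩
  countBelow m xs + occurrences m xs ≤⟨ +-mono-≤ (countBelow-unique unique)
                                                  (occurrences-unique unique) ⟩
  m + 1                              ≡⟨ +-comm m 1 ⟩
  suc m                              ∎
  where open ≤-Reasoning

countBelow-mono-suc : ∀ m xs → countBelow m xs ≤ countBelow (suc m) xs
countBelow-mono-suc m xs = ≤-trans (m≤m+n _ _) (≤-reflexive (sym (countBelow-suc m xs)))

PeakBound : ℕ → List ℕ → Set
PeakBound m xs = 2 * countBelow m (peaks xs) ≤ countBelow m xs ∸ 1

-- A peak below m has both neighbours below m, and after a peak b with right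
-- neighbour c < b the next possible peak lies beyond c.
peakBound-step : ∀ m a b c r →
  PeakBound m (b ∷ c ∷ r) → PeakBound m (c ∷ r) → PeakBound m (a ∷ b ∷ c ∷ r)
peakBound-step m a b c r ih₁ ih₂ with a <? b ×-dec c <? b
... | no _ = ≤-trans ih₁ (∸-monoˡ-≤ 1 (countBelow-∷ m a (b ∷ c ∷ r)))
... | yes (a<b , c<b) with b <? m
...   | no b≮m = begin
  2 * countBelow m (b ∷ peaks (b ∷ c ∷ r)) ≡⟨ cong (2 *_) (countBelow-reject _ b≮m) ⟩
  2 * countBelow m (peaks (b ∷ c ∷ r))     ≤⟨ ih₁ ⟩
  countBelow m (b ∷ c ∷ r) ∸ 1             ≤⟨ ∸-monoˡ-≤ 1 (countBelow-∷ m a _) ⟩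
  countBelow m (a ∷ b ∷ c ∷ r) ∸ 1         ∎
  where open ≤-Reasoning
...   | yes b<m = begin
  2 * countBelow m (b ∷ peaks (b ∷ c ∷ r)) ≡⟨ cong (2 *_) (countBelow-accept _ b<m) ⟩
  2 * suc (countBelow m (peaks (b ∷ c ∷ r)))
                                           ≡⟨ cong (λ ps → 2 * suc (countBelow m ps)) (peaks-descent r c<b) ⟩
  2 * suc (countBelow m (peaks (c ∷ r)))   ≡⟨ *-suc 2 _ ⟩
  2 + 2 * countBelow m (peaks (c ∷ r))     ≤⟨ +-monoʳ-≤ 2 ih₂ ⟩
  2 + (countBelow m (c ∷ r) ∸ 1)           ≡⟨ cong (λ e → 2 + (e ∸ 1)) (countBelow-accept r c<m) ⟩
  2 + countBelow m r                       ≡⟨ cong (_∸ 1) countBelow-abcr ⟨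
  countBelow m (a ∷ b ∷ c ∷ r) ∸ 1         ∎
  where
  open ≤-Reasoning
  c<m = <-trans c<b b<m
  countBelow-abcr : countBelow m (a ∷ b ∷ c ∷ r) ≡ 3 + countBelow m r
  countBelow-abcr =
    trans (countBelow-accept _ (<-trans a<b b<m))
          (cong suc (trans (countBelow-accept _ b<m) (cong suc (countBelow-accept r c<m))))

peakBound : ∀ m xs → PeakBound m xs
peakBound m []              = z≤n
peakBound m (_ ∷ [])        = z≤n
peakBound m (_ ∷ _ ∷ [])    = z≤n
peakBound m (a ∷ b ∷ c ∷ r) =
  peakBound-step m a b c r (peakBound m (b ∷ c ∷ r)) (peakBound m (c ∷ r))

record OneLine (σ : Permutation′ n) (xs : List ℕ) : Set where
  constructor mkOneLine
  field
    length≡ : length xs ≡ n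
    nth≡    : ∀ i → toℕ (σ ⟨$⟩ʳ i) ≡ nth xs (toℕ i)

module _ {σ : Permutation′ n} (oneLine : OneLine σ xs) where
  private
    at : ∀ {i p} → toℕ i ≡ p → toℕ (σ ⟨$⟩ʳ i) ≡ nth xs p
    at refl = OneLine.nth≡ oneLine _

  circPeak⇒peakAt : ∀ {v} → IsCircPeak σ v → ∃ (PeakAt xs (toℕ v))
  circPeak⇒peakAt (i , j , k , j≡1+i , k≡1+j , σi<σj , σk<σj , refl) =
    toℕ i ,
    subst₂ _<_ k≡2+i (sym (OneLine.length≡ oneLine)) (Finₚ.toℕ<n k) ,
    sym (at j≡1+i) ,
    subst (_< _) (at refl) σi<σj ,
    subst (_< _) (at k≡2+i) σk<σj
    where k≡2+i = trans k≡1+j (cong suc j≡1+i)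

  peakAt⇒circPeak : ∀ {v} → ∃ (PeakAt xs (toℕ v)) → IsCircPeak σ v
  peakAt⇒circPeak (p , 2+p<len , x₁₊ₚ≡v , xₚ<v , x₂₊ₚ<v) =
    i , j , k ,
    trans (Finₚ.toℕ-fromℕ< 1+p<n) (cong suc (sym (Finₚ.toℕ-fromℕ< p<n))) ,
    trans (Finₚ.toℕ-fromℕ< 2+p<n) (cong suc (sym (Finₚ.toℕ-fromℕ< 1+p<n))) ,
    subst₂ _<_ (sym (at (Finₚ.toℕ-fromℕ< p<n))) (sym σj≡v) xₚ<v ,
    subst₂ _<_ (sym (at (Finₚ.toℕ-fromℕ< 2+p<n))) (sym σj≡v) x₂₊ₚ<v ,
    Finₚ.toℕ-injective σj≡v
    where
    2+p<n = subst (2 + p <_) (OneLine.length≡ oneLine) 2+p<len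
    1+p<n = <⇒≤ 2+p<n
    p<n   = <⇒≤ 1+p<n
    i = fromℕ< p<n
    j = fromℕ< 1+p<n
    k = fromℕ< 2+p<n
    σj≡v = trans (at (Finₚ.toℕ-fromℕ< 1+p<n)) x₁₊ₚ≡v

  circPeak⇔∈peaks : ∀ {v} → IsCircPeak σ v ⇔ toℕ v ∈ peaks xs
  circPeak⇔∈peaks =
    ⇔-trans (mk⇔ circPeak⇒peakAt peakAt⇒circPeak) (⇔-sym (∈-peaks⇔ {xs = xs}))

oneLine-tabulate : (σ : Permutation′ n) → OneLine σ (tabulate (toℕ ∘ (σ ⟨$⟩ʳ_)))
oneLine-tabulate σ = mkOneLine (length-tabulate _) λ i → sym (nth-tabulate _ i)

unique-tabulate : (σ : Permutation′ n) → Unique (tabulate (toℕ ∘ (σ ⟨$⟩ʳ_)))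
unique-tabulate σ = tabulate⁺ (Injection.injective (↔⇒↣ σ) ∘ Finₚ.toℕ-injective)

fromOneLine : xs ↭ upTo n → ∃ λ (σ : Permutation′ n) → OneLine σ xs
fromOneLine {xs} {n} xs↭upTo =
  permutation f g f∘g g∘f , mkOneLine len λ i → Finₚ.toℕ-fromℕ< _
  where
  len : length xs ≡ n
  len = trans (↭-length xs↭upTo) (length-upTo n)
  unique : Unique xs
  unique = Unique-resp-↭ (↭⇒↭ₛ (↭-sym xs↭upTo)) (upTo⁺ n)
  inRange : (i : Fin n) → toℕ i < length xs
  inRange i = subst (toℕ i <_) (sym len) (Finₚ.toℕ<n i)
  f : Fin n → Fin n
  f i = fromℕ< (∈-upTo⁻ (∈-resp-↭ xs↭upTo (nth-∈ (inRange i))))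
  position : ∀ y → Σ (Fin n) λ p → nth xs (toℕ p) ≡ toℕ y
  position y
    with p , p<len , nthₚ≡y ← ∈⇒nth (∈-resp-↭ (↭-sym xs↭upTo) (∈-upTo⁺ (Finₚ.toℕ<n y)))
    = fromℕ< (subst (p <_) len p<len) , trans (cong (nth xs) (Finₚ.toℕ-fromℕ< _)) nthₚ≡y
  g : Fin n → Fin n
  g = proj₁ ∘ position
  f∘g : ∀ y → f (g y) ≡ y
  f∘g y = Finₚ.toℕ-injective (trans (Finₚ.toℕ-fromℕ< _) (proj₂ (position y)))
  g∘f : ∀ i → g (f i) ≡ i
  g∘f i = Finₚ.toℕ-injective (nth-injective unique (inRange (g (f i))) (inRange i)
    (trans (proj₂ (position (f i))) (Finₚ.toℕ-fromℕ< _)))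

-- Necessity of the ballot condition

-- sizeBelow S m = |S ∩ [m]|, since S holds the values shifted down by one.
sizeBelow : Subset n → ℕ → ℕ
sizeBelow _             zero    = 0
sizeBelow []            (suc _) = 0
sizeBelow (inside ∷ S)  (suc m) = suc (sizeBelow S m)
sizeBelow (outside ∷ S) (suc m) = sizeBelow S m

HasValue : Subset n → ℕ → Set
HasValue S m = ∃ λ v → v ∈ₛ S × toℕ v ≡ m

HasValue-∷ : ∀ {s} {S : Subset n} → HasValue S m → HasValue (s ∷ S) (suc m)
HasValue-∷ (v , v∈S , refl) = Fin.suc v , there v∈S , refl

sizeBelow-suc : ∀ (S : Subset n) m →
  sizeBelow S (suc m) ≡ sizeBelow S m ⊎
  sizeBelow S (suc m) ≡ suc (sizeBelow S m) × HasValue S m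
sizeBelow-suc []            zero    = inj₁ refl
sizeBelow-suc []            (suc _) = inj₁ refl
sizeBelow-suc (inside ∷ _)  zero    = inj₂ (refl , Fin.zero , here , refl)
sizeBelow-suc (outside ∷ _) zero    = inj₁ refl
sizeBelow-suc (inside ∷ S)  (suc m) =
  Sum.map (cong suc) (Product.map (cong suc) HasValue-∷) (sizeBelow-suc S m)
sizeBelow-suc (outside ∷ S) (suc m) =
  Sum.map₂ (Product.map₂ HasValue-∷) (sizeBelow-suc S m)

sizeBelow≤countBelow : ∀ {S : Subset n} → (∀ {v} → v ∈ₛ S → toℕ v ∈ xs) →
  ∀ m → sizeBelow S m ≤ countBelow m xs
sizeBelow≤countBelow _ zero = z≤n
sizeBelow≤countBelow {xs = xs} {S} S⊆xs (suc m) with sizeBelow-suc S m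
... | inj₁ eq = begin
  sizeBelow S (suc m) ≡⟨ eq ⟩
  sizeBelow S m       ≤⟨ sizeBelow≤countBelow S⊆xs m ⟩
  countBelow m xs     ≤⟨ countBelow-mono-suc m xs ⟩
  countBelow (suc m) xs ∎
  where open ≤-Reasoning
... | inj₂ (eq , v , v∈S , refl) = begin
  sizeBelow S (suc m)                ≡⟨ eq ⟩
  suc (sizeBelow S m)                ≡⟨ +-comm 1 _ ⟩
  sizeBelow S m + 1                  ≤⟨ +-mono-≤ (sizeBelow≤countBelow S⊆xs m)
                                                 (occurrences-∈ (S⊆xs v∈S)) ⟩
  countBelow m xs + occurrences m xs ≡⟨ countBelow-suc m xs ⟨
  countBelow (suc m) xs              ∎
  where open ≤-Reasoning

sizeBelow-mono : ∀ {T S : Subset n} → T ⊆ₛ S → ∀ m → sizeBelow T m ≤ sizeBelow S m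
sizeBelow-mono _ zero = z≤n
sizeBelow-mono {T = []} {[]} _ (suc _) = z≤n
sizeBelow-mono {T = outside ∷ _} {outside ∷ _} T⊆S (suc m) = sizeBelow-mono (drop-∷-⊆ T⊆S) m
sizeBelow-mono {T = outside ∷ _} {inside ∷ _}  T⊆S (suc m) =
  m≤n⇒m≤1+n (sizeBelow-mono (drop-∷-⊆ T⊆S) m)
sizeBelow-mono {T = inside ∷ _}  {inside ∷ _}  T⊆S (suc m) =
  s≤s (sizeBelow-mono (drop-∷-⊆ T⊆S) m)
sizeBelow-mono {T = inside ∷ _}  {outside ∷ _} T⊆S (suc _) with () ← T⊆S here

sizeBelow-∈ : ∀ {S : Subset n} {v} → v ∈ₛ S → 1 ≤ sizeBelow S (suc (toℕ v))
sizeBelow-∈ {S = inside ∷ _}                  _           = s≤s z≤n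
sizeBelow-∈ {S = outside ∷ _} {v = Fin.suc _} (there v∈S) = sizeBelow-∈ v∈S

∣∣≡sizeBelow : ∀ (S : Subset n) → ∣ S ∣ ≡ sizeBelow S n
∣∣≡sizeBelow []            = refl
∣∣≡sizeBelow (inside ∷ S)  = cong suc (∣∣≡sizeBelow S)
∣∣≡sizeBelow (outside ∷ S) = ∣∣≡sizeBelow S

-- Ballot 0 S is the paper's condition 2 |S ∩ [m]| ≤ m - 1, indexed from m = 1.
Ballot : ℕ → Subset n → Set
Ballot k S = ∀ m → 2 * sizeBelow S (suc m) ≤ k + m

ballot-⊆ : ∀ {k} {T S : Subset n} → T ⊆ₛ S → Ballot k S → Ballot k T
ballot-⊆ T⊆S ballot m = ≤-trans (*-monoʳ-≤ 2 (sizeBelow-mono T⊆S (suc m))) (ballot m)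

inP⇒ballot : ∀ {S : Subset n} → InP n S → Ballot 0 S
inP⇒ballot {S = S} (σ , σ-peaks) m = begin
  2 * sizeBelow S (suc m)
    ≤⟨ *-monoʳ-≤ 2 (sizeBelow≤countBelow S⊆peaks (suc m)) ⟩
  2 * countBelow (suc m) (peaks values)
    ≤⟨ peakBound (suc m) values ⟩
  countBelow (suc m) values ∸ 1
    ≤⟨ ∸-monoˡ-≤ 1 (countBelow-unique (unique-tabulate σ)) ⟩
  m ∎
  where
  open ≤-Reasoning
  values = tabulate (toℕ ∘ (σ ⟨$⟩ʳ_))
  S⊆peaks : ∀ {v} → v ∈ₛ S → toℕ v ∈ peaks values
  S⊆peaks {v} v∈S =
    Equivalence.to (circPeak⇔∈peaks (oneLine-tabulate σ)) (Equivalence.to (σ-peaks v) v∈S)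

-- Sufficiency: arranging the values

membersFrom : ℕ → Subset n → List ℕ
membersFrom t []            = []
membersFrom t (inside ∷ S)  = t ∷ membersFrom (suc t) S
membersFrom t (outside ∷ S) = membersFrom (suc t) S

∈-membersFrom⁺ : ∀ t {S : Subset n} {v} → v ∈ₛ S → t + toℕ v ∈ membersFrom t S
∈-membersFrom⁺ t {inside ∷ _}  {Fin.zero}  here        = here (+-identityʳ t)
∈-membersFrom⁺ t {inside ∷ S}  {Fin.suc v} (there v∈S) =
  there (subst (_∈ membersFrom (suc t) S) (sym (+-suc t _)) (∈-membersFrom⁺ (suc t) v∈S))
∈-membersFrom⁺ t {outside ∷ S} {Fin.suc v} (there v∈S) =
  subst (_∈ membersFrom (suc t) S) (sym (+-suc t _)) (∈-membersFrom⁺ (suc t) v∈S)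

∈-membersFrom⁻ : ∀ t (S : Subset n) → w ∈ membersFrom t S →
                 ∃ λ v → v ∈ₛ S × t + toℕ v ≡ w
∈-membersFrom⁻ t (inside ∷ S) (here refl) = Fin.zero , here , +-identityʳ t
∈-membersFrom⁻ t (inside ∷ S) (there w∈)
  with v , v∈S , refl ← ∈-membersFrom⁻ (suc t) S w∈ = Fin.suc v , there v∈S , +-suc t _
∈-membersFrom⁻ t (outside ∷ S) w∈
  with v , v∈S , refl ← ∈-membersFrom⁻ (suc t) S w∈ = Fin.suc v , there v∈S , +-suc t _

∈⇔∈membersFrom : ∀ {S : Subset n} {v} → v ∈ₛ S ⇔ toℕ v ∈ membersFrom 0 S
∈⇔∈membersFrom {S = S} = mk⇔ (∈-membersFrom⁺ 0) λ v∈ →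
  let u , u∈S , u≡v = ∈-membersFrom⁻ 0 S v∈
  in  subst (_∈ₛ S) (Finₚ.toℕ-injective u≡v) u∈S

-- Reading S from value 0 upwards with k values still free to serve as valleys:
-- a non-peak becomes free, a peak needs two free values and uses up one.
Admissible : ℕ → Subset n → Set
Admissible k []            = ⊤
Admissible k (outside ∷ S) = Admissible (suc k) S
Admissible k (inside ∷ S)  = 2 ≤ k × Admissible (pred k) S

-- A non-peak is parked in the
-- increasing list of pending values; a peak is written out right after the least
-- pending value, and the next pending value becomes its right neighbour.
arrange : ℕ → List ℕ → Subset n → List ℕ
arrange t pending       []            = pending
arrange t pending       (outside ∷ S) = arrange (suc t) (pending ∷ʳ t) S
arrange t []            (inside ∷ S)  = t ∷ arrange (suc t) [] S
arrange t (v ∷ pending) (inside ∷ S)  = v ∷ t ∷ arrange (suc t) pending S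

arrange-∷ : ∀ t v pending (S : Subset n) →
            ∃ λ rest → arrange t (v ∷ pending) S ≡ v ∷ rest
arrange-∷ t v pending []            = pending , refl
arrange-∷ t v pending (outside ∷ S) = arrange-∷ (suc t) v (pending ∷ʳ t) S
arrange-∷ t v pending (inside ∷ S)  = _ , refl

applyUpTo-cong : ∀ {f g : ℕ → ℕ} → (∀ i → f i ≡ g i) →
                 ∀ m → applyUpTo f m ≡ applyUpTo g m
applyUpTo-cong f≗g zero    = refl
applyUpTo-cong f≗g (suc m) = cong₂ _∷_ (f≗g 0) (applyUpTo-cong (f≗g ∘ suc) m)

applyUpTo-+-suc : ∀ t m → applyUpTo (_+_ t) (suc m) ≡ t ∷ applyUpTo (_+_ (suc t)) m
applyUpTo-+-suc t m = cong₂ _∷_ (+-identityʳ t) (applyUpTo-cong (+-suc t) m)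

arrange-↭ : ∀ t pending (S : Subset n) → arrange t pending S ↭ pending ++ applyUpTo (_+_ t) n
arrange-↭ t pending [] = ↭-reflexive (sym (++-identityʳ pending))
arrange-↭ {suc n} t pending (outside ∷ S) = begin
  arrange (suc t) (pending ∷ʳ t) S            ↭⟨ arrange-↭ (suc t) (pending ∷ʳ t) S ⟩
  (pending ∷ʳ t) ++ applyUpTo (_+_ (suc t)) n ≡⟨ ++-assoc pending (t ∷ []) _ ⟩
  pending ++ t ∷ applyUpTo (_+_ (suc t)) n    ≡⟨ cong (pending ++_) (applyUpTo-+-suc t n) ⟨
  pending ++ applyUpTo (_+_ t) (suc n)        ∎
  where open PermutationReasoning
arrange-↭ {suc n} t [] (inside ∷ S) = begin
  t ∷ arrange (suc t) [] S      ↭⟨ prep t (arrange-↭ (suc t) [] S) ⟩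
  t ∷ applyUpTo (_+_ (suc t)) n ≡⟨ applyUpTo-+-suc t n ⟨
  applyUpTo (_+_ t) (suc n)     ∎
  where open PermutationReasoning
arrange-↭ {suc n} t (v ∷ pending) (inside ∷ S) = begin
  v ∷ t ∷ arrange (suc t) pending S            ↭⟨ prep v (prep t (arrange-↭ (suc t) pending S)) ⟩
  v ∷ t ∷ pending ++ applyUpTo (_+_ (suc t)) n ↭⟨ prep v (shift t pending _) ⟨
  v ∷ pending ++ t ∷ applyUpTo (_+_ (suc t)) n ≡⟨ cong (λ ys → v ∷ pending ++ ys)
                                                       (applyUpTo-+-suc t n) ⟨
  v ∷ pending ++ applyUpTo (_+_ t) (suc n)     ∎
  where open PermutationReasoning

peaks-arrange : ∀ t pending (S : Subset n) → AllPairs _<_ pending → All (_< t) pending →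
                Admissible (length pending) S → peaks (arrange t pending S) ≡ membersFrom t S
peaks-arrange t pending [] sorted _ _ = peaks-sorted sorted
peaks-arrange t pending (outside ∷ S) sorted below adm =
  peaks-arrange (suc t) (pending ∷ʳ t) S
    (AllPairs.++⁺ sorted ([] ∷ []) (All.map (_∷ []) below))
    (All.∷ʳ⁺ (All.map m<n⇒m<1+n below) (n<1+n t))
    (subst (λ k → Admissible k S) (sym (trans (length-++ pending) (+-comm _ 1))) adm)
peaks-arrange t []       (inside ∷ S) _ _ (() , _)
peaks-arrange t (_ ∷ []) (inside ∷ S) _ _ (s≤s () , _)
peaks-arrange t (v ∷ v′ ∷ pending) (inside ∷ S) (_ ∷ sorted) (v<t ∷ v′<t ∷ below) (_ , adm)
  with rest , eq ← arrange-∷ (suc t) v′ pending S = begin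
  peaks (v ∷ t ∷ arrange (suc t) (v′ ∷ pending) S) ≡⟨ cong (λ ys → peaks (v ∷ t ∷ ys)) eq ⟩
  peaks (v ∷ t ∷ v′ ∷ rest)                        ≡⟨ peaks-peak rest v<t v′<t ⟩
  t ∷ peaks (t ∷ v′ ∷ rest)                        ≡⟨ cong (t ∷_) (peaks-descent rest v′<t) ⟩
  t ∷ peaks (v′ ∷ rest)                            ≡⟨ cong (λ ys → t ∷ peaks ys) eq ⟨
  t ∷ peaks (arrange (suc t) (v′ ∷ pending) S)     ≡⟨ cong (t ∷_) ih ⟩
  t ∷ membersFrom (suc t) S                        ∎
  where
  open ≡-Reasoning
  ih = peaks-arrange (suc t) (v′ ∷ pending) S sorted (All.map m<n⇒m<1+n (v′<t ∷ below)) adm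

admissible⇒inP : ∀ {S : Subset n} → Admissible 0 S → InP n S
admissible⇒inP {n} {S} adm with σ , oneLine ← fromOneLine (arrange-↭ 0 [] S) =
  σ , λ v → ⇔-trans
    (subst (λ ys → v ∈ₛ S ⇔ toℕ v ∈ ys) (sym (peaks-arrange 0 [] S [] [] adm))
           (∈⇔∈membersFrom {S = S}))
    (⇔-sym (circPeak⇔∈peaks oneLine))

ballot⇒admissible : ∀ k (S : Subset n) → Ballot k S → Admissible k S
ballot⇒admissible k [] _ = tt
ballot⇒admissible k (outside ∷ S) ballot =
  ballot⇒admissible (suc k) S λ m →
    subst (2 * sizeBelow S (suc m) ≤_) (+-suc k m) (ballot (suc m))
ballot⇒admissible zero (inside ∷ S) ballot = contradiction (ballot 0) λ ()
ballot⇒admissible (suc zero) (inside ∷ S) ballot = contradiction (ballot 0) λ { (s≤s ()) }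
ballot⇒admissible (suc (suc k)) (inside ∷ S) ballot =
  s≤s (s≤s z≤n) , ballot⇒admissible (suc k) S λ m →
    subst (2 * sizeBelow S (suc m) ≤_) (+-suc k m)
      (s≤s⁻¹ (s≤s⁻¹ (subst (_≤ 2 + k + suc m) (*-suc 2 _) (ballot (suc m)))))

inP⇔ballot : ∀ {S : Subset n} → InP n S ⇔ Ballot 0 S
inP⇔ballot {S = S} = mk⇔ inP⇒ballot (admissible⇒inP ∘ ballot⇒admissible 0 S)

-- Faces of the complex

admissible-∅ : ∀ n k → Admissible k (∅ {n})
admissible-∅ zero    k = tt
admissible-∅ (suc n) k = admissible-∅ n (suc k)

admissible-⁅⁆ : ∀ k (v : Fin n) → 2 ≤ k + toℕ v → Admissible k ⁅ v ⁆
admissible-⁅⁆ {suc n} k Fin.zero    2≤k   =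
  subst (2 ≤_) (+-identityʳ k) 2≤k , admissible-∅ n (pred k)
admissible-⁅⁆ {suc n} k (Fin.suc v) 2≤k+v =
  admissible-⁅⁆ (suc k) v (subst (2 ≤_) (+-suc k (toℕ v)) 2≤k+v)

alternating : ∀ n → Subset n
alternating zero          = []
alternating (suc zero)    = outside ∷ []
alternating (suc (suc n)) = outside ∷ inside ∷ alternating n

admissible-alternating : ∀ k n → Admissible (suc k) (alternating n)
admissible-alternating k zero          = tt
admissible-alternating k (suc zero)    = tt
admissible-alternating k (suc (suc n)) = s≤s (s≤s z≤n) , admissible-alternating k n

∣alternating∣ : ∀ n → ∣ alternating n ∣ ≡ n / 2
∣alternating∣ zero          = refl
∣alternating∣ (suc zero)    = refl
∣alternating∣ (suc (suc n)) =
  trans (cong suc (∣alternating∣ n)) (sym (m/n≡1+[m∸n]/n {suc (suc n)} (s≤s (s≤s z≤n))))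

2*m≤n⇒m≤n/2 : 2 * m ≤ n → m ≤ n / 2
2*m≤n⇒m≤n/2 {m} {n} 2m≤n =
  subst (_≤ n / 2) (m*n/n≡m m 2) (/-monoˡ-≤ 2 (subst (_≤ n) (*-comm 2 m) 2m≤n))

inP-vertex : (S : Subset n) → InP n S → (v : Fin n) → v ∈ₛ S → InVertexRange 3 v
inP-vertex S S∈P v v∈S =
  s≤s (≤-trans (*-monoʳ-≤ 2 (sizeBelow-∈ v∈S)) (inP⇒ballot S∈P (toℕ v)))

inP-⁅⁆ : (v : Fin n) → InVertexRange 3 v → InP n ⁅ v ⁆
inP-⁅⁆ v 3≤1+v = admissible⇒inP (admissible-⁅⁆ 0 v (s≤s⁻¹ 3≤1+v))

inP-⊆ : (S T : Subset n) → T ⊆ₛ S → InP n S → InP n T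
inP-⊆ _ _ T⊆S = Equivalence.from inP⇔ballot ∘ ballot-⊆ T⊆S ∘ Equivalence.to inP⇔ballot

∣∣≤[n∸1]/2 : ∀ {S : Subset n} → InP n S → ∣ S ∣ ≤ (n ∸ 1) / 2
∣∣≤[n∸1]/2 {zero}  {[]} _   = z≤n
∣∣≤[n∸1]/2 {suc n} {S}  S∈P =
  2*m≤n⇒m≤n/2 (subst (λ s → 2 * s ≤ n) (sym (∣∣≡sizeBelow S)) (inP⇒ballot S∈P n))

-- In 1-based values the face is {3, 5, 7, …}.
maximalFace : ∀ n → ∃ λ (S : Subset n) → InP n S × ∣ S ∣ ≡ (n ∸ 1) / 2
maximalFace zero    = [] , admissible⇒inP tt , refl
maximalFace (suc n) =
  outside ∷ alternating n , admissible⇒inP (admissible-alternating 0 n) , ∣alternating∣ n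

faceDim≤ : ∀ {S : Subset n} {d} → ∣ S ∣ ≤ d → faceDim S ℤ.≤ + d - + 1
faceDim≤ ∣S∣≤d = ℤ.+-monoˡ-≤ (ℤ.- (+ 1)) (ℤ.+≤+ ∣S∣≤d)

theorem3p1 : (n : ℕ) → 3 ≤ n →
    IsSimplicialComplexOn n 3 (InP n) ×
    HasDimension n (InP n) (+ ((n ∸ 1) / 2) - + 1)
theorem3p1 n _ with S , S∈P , ∣S∣≡ ← maximalFace n =
  (inP-vertex , inP-⁅⁆ , inP-⊆) ,
  (S , S∈P , cong (λ s → + s - + 1) ∣S∣≡) ,
  λ T T∈P → faceDim≤ {S = T} (∣∣≤[n∸1]/2 T∈P)
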